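{- Let $G=(V,E)$ be a simple, finite, connected reflective graph and $x\in V$. Assume the induced subgraph on $S_1(x)$ is connected. Then $S_1(x)$ is isometric, i.e. for all $w,w'\in S_1(x)$ there exists a shortest path in $G$ from $w$ to $w'$ all of whose vertices lie in $S_1(x)$.
   Context: $d$ is the graph distance and $S_n(x)=\{y:d(x,y)=n\}$. For adjacent $x\sim y$ let $V_x^y=\{x': d(x',x)<d(x',y)\}$, $V^{xy}=\{z: d(z,x)=d(z,y)\}$. A reflection from $x$ to $y$ is a graph automorphism $\phi$ with $\phi^2=\mathrm{id}$, $\phi(x)=y$, such that the set of edges between $V_x^y$ and $V_y^x$ is exactly $\{(x',\phi(x')):x'\in V_x^y\}$, and $\phi$ fixes every vertex of $V^{xy}$. $G$ is reflective if a reflection from $x$ to $y$ exists for every edge $x\sim y$. -}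

module Defs where

open import Data.Nat using (ℕ; suc; _<_; _≤_)
open import Data.Fin using (Fin)
open import Data.List using (List; []; _∷_; length)
open import Data.List.Relation.Unary.All using (All)
open import Data.Product using (Σ; _×_; ∃; ∃-syntax)
open import Relation.Nullary using (¬_)
open import Relation.Binary.PropositionalEquality using (_≡_)
open import Function.Bundles using (_⇔_)

record Graph : Set₁ where
  field
    n    : ℕ
    Adj  : Fin n → Fin n → Set
    irrefl : ∀ {u} → ¬ Adj u u
    sym  : ∀ {u v} → Adj u v → Adj v u

module _ (G : Graph) where
  open Graph G

  data Walk : Fin n → Fin n → Set where
    [] : ∀ {u} → Walk u u
    _∷_ : ∀ {u v w} → Adj u v → Walk v w → Walk u w

  walkLength : ∀ {u v} → Walk u v → ℕ
  walkLength [] = 0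
  walkLength (_ ∷ p) = suc (walkLength p)

  vertices : ∀ {u v} → Walk u v → List (Fin n)
  vertices {u} [] = u ∷ []
  vertices {u} (_ ∷ p) = u ∷ vertices p

  Connected : Set
  Connected = ∀ u v → Walk u v

  Dist : Fin n → Fin n → ℕ → Set
  Dist u v k = (Σ (Walk u v) λ p → walkLength p ≡ k)
             × (∀ (p : Walk u v) → k ≤ walkLength p)

  DistLt : Fin n → Fin n → Fin n → Fin n → Set
  DistLt u v u' v' = ∀ k l → Dist u v k → Dist u' v' l → k < l

  DistEq : Fin n → Fin n → Fin n → Fin n → Set
  DistEq u v u' v' = ∀ k l → Dist u v k → Dist u' v' l → k ≡ l

  Sphere : ℕ → Fin n → Fin n → Set
  Sphere m x y = Dist x y m

  Half : Fin n → Fin n → Fin n → Set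
  Half x y x' = DistLt x' x x' y

  Mid : Fin n → Fin n → Fin n → Set
  Mid x y z = DistEq z x z y

  record IsAutomorphism (φ : Fin n → Fin n) : Set where
    field
      injective : ∀ {a b} → φ a ≡ φ b → a ≡ b
      surjective : ∀ b → ∃[ a ] φ a ≡ b
      preserves : ∀ a b → Adj a b ⇔ Adj (φ a) (φ b)

  record IsReflection (x y : Fin n) (φ : Fin n → Fin n) : Set where
    field
      automorphism : IsAutomorphism φ
      involution : ∀ a → φ (φ a) ≡ a
      maps : φ x ≡ y
      edges : ∀ a b → Half x y a → Half y x b → (Adj a b ⇔ (b ≡ φ a))
      edges-image : ∀ a → Half x y a → Half y x (φ a)
      fixes : ∀ z → Mid x y z → φ z ≡ z

  Reflective : Set
  Reflective = ∀ x y → Adj x y → ∃[ φ ] IsReflection x y φ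

  InducedConnected : (Fin n → Set) → Set
  InducedConnected P = ∀ u v → P u → P v → Σ (Walk u v) λ p → All P (vertices p)

  Isometric : (Fin n → Set) → Set
  Isometric P = ∀ u v → P u → P v →
    Σ (Walk u v) λ p → Dist u v (walkLength p) × All P (vertices p)

-- In a reflective graph, adjacency between two neighbours a, b of x is
-- decidable: the reflection φ from x to a fixes b iff a ~ b.  Now let u, v be
-- non-adjacent vertices of S₁(x) and walk inside S₁(x) from u towards v.
-- The property "q = v, or q ~ v, or q and v have a common neighbour in S₁(x)"
-- holds at v and propagates backwards along the walk: if q ~ p and p has a
-- common neighbour m with v, while q is at distance 2 from v, then the
-- reflection τ from p to q fixes x and v (both are equidistant from p and q),
-- so τ m is a common neighbour of q and v in S₁(x).  Hence d(u,v) = 2 is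
-- realised by a path through S₁(x).
module Submission where

open import Defs
open import Data.Fin using (Fin; _≟_)
open import Data.Nat using (_≤_; z≤n; s≤s)
open import Data.Nat.Properties using (≤-antisym)
open import Data.List.Relation.Unary.All using (All; []; _∷_)
open import Data.Product using (_×_; _,_; ∃-syntax)
open import Data.Sum using (_⊎_; inj₁; inj₂)
open import Data.Empty using (⊥-elim)
open import Relation.Nullary using (¬_; Dec; yes; no)
open import Relation.Binary.PropositionalEquality using (_≡_; _≢_; refl; sym; trans; subst; subst₂)
open import Function using (_∘_)
open import Function.Bundles using (Equivalence)

module _ (G : Graph) where
  open Graph G renaming (sym to Adj-sym)

  Dist-functional : ∀ {u v k l} → Dist G u v k → Dist G u v l → k ≡ l
  Dist-functional {k = k} {l} ((p , ∣p∣≡k) , k≤) ((q , ∣q∣≡l) , l≤) =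
    ≤-antisym (subst (k ≤_) ∣q∣≡l (k≤ q)) (subst (l ≤_) ∣p∣≡k (l≤ p))

  Adj⇒Dist1 : ∀ {u v} → Adj u v → Dist G u v 1
  Adj⇒Dist1 {u} {v} u~v = (u~v ∷ [] , refl) , lower-bound
    where
    lower-bound : (p : Walk G u v) → 1 ≤ walkLength G p
    lower-bound [] = ⊥-elim (irrefl u~v)
    lower-bound (_ ∷ _) = s≤s z≤n

  Dist1⇒Adj : ∀ {u v} → Dist G u v 1 → Adj u v
  Dist1⇒Adj ((u~v ∷ [] , refl) , _) = u~v

  commonNeighbour⇒Dist2 : ∀ {u v c} → u ≢ v → ¬ Adj u v → Adj u c → Adj c v →
                          Dist G u v 2
  commonNeighbour⇒Dist2 {u} {v} u≢v u≁v u~c c~v = (u~c ∷ c~v ∷ [] , refl) , lower-bound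
    where
    lower-bound : (p : Walk G u v) → 2 ≤ walkLength G p
    lower-bound [] = ⊥-elim (u≢v refl)
    lower-bound (u~v ∷ []) = ⊥-elim (u≁v u~v)
    lower-bound (_ ∷ _ ∷ _) = s≤s (s≤s z≤n)

  equidistant⇒Mid : ∀ {z a b j} → Dist G z a j → Dist G z b j → Mid G a b z
  equidistant⇒Mid z-a z-b k l z-a-k z-b-l =
    trans (Dist-functional z-a-k z-a) (Dist-functional z-b z-b-l)

  module _ {a b φ} (reflection : IsReflection G a b φ) where
    open IsReflection reflection

    reflection-preserves-Adj : ∀ {u v} → Adj u v → Adj (φ u) (φ v)
    reflection-preserves-Adj {u} {v} =
      Equivalence.to (IsAutomorphism.preserves automorphism u v)

    reflection-fixes-equidistant : ∀ {z j} → Dist G z a j → Dist G z b j → φ z ≡ z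
    reflection-fixes-equidistant z-a z-b = fixes _ (equidistant⇒Mid z-a z-b)

    reflection-fixes-commonNeighbour : ∀ {z} → Adj z a → Adj z b → φ z ≡ z
    reflection-fixes-commonNeighbour z~a z~b =
      reflection-fixes-equidistant (Adj⇒Dist1 z~a) (Adj⇒Dist1 z~b)

  module _ (reflective : Reflective G) where

    neighbours-Adj? : ∀ {x a b} → Adj x a → Adj x b → Dec (Adj a b)
    neighbours-Adj? {x} {a} {b} x~a x~b with reflective x a x~a
    ... | φ , reflection with φ b ≟ b
    ... | yes φb≡b = yes (subst₂ Adj (IsReflection.maps reflection) φb≡b
                                  (reflection-preserves-Adj reflection x~b))
    ... | no φb≢b = no λ a~b →
          φb≢b (reflection-fixes-commonNeighbour reflection (Adj-sym x~b) (Adj-sym a~b))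

    module _ (x w : Fin n) (x~w : Adj x w) where

      WithinTwo : Fin n → Set
      WithinTwo q = q ≡ w ⊎ Adj q w ⊎ ∃[ c ] Adj x c × Adj q c × Adj c w

      WithinTwo-backward : ∀ {q p} → Adj x q → Adj x p → Adj q p →
                           WithinTwo p → WithinTwo q
      WithinTwo-backward _ _ q~p (inj₁ refl) = inj₂ (inj₁ q~p)
      WithinTwo-backward _ x~p q~p (inj₂ (inj₁ p~w)) = inj₂ (inj₂ (_ , x~p , q~p , p~w))
      WithinTwo-backward {q} {p} x~q x~p q~p (inj₂ (inj₂ (m , x~m , p~m , m~w)))
        with q ≟ w | neighbours-Adj? x~q x~w
      ... | yes q≡w | _ = inj₁ q≡w
      ... | no _ | yes q~w = inj₂ (inj₁ q~w)
      ... | no q≢w | no q≁w with p ≟ w | neighbours-Adj? x~p x~w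
      ...   | yes refl | _ = inj₂ (inj₁ q~p)
      ...   | no _ | yes p~w = inj₂ (inj₂ (_ , x~p , q~p , p~w))
      ...   | no p≢w | no p≁w with reflective p q (Adj-sym q~p)
      ...     | τ , reflection = inj₂ (inj₂ (τ m , x~τm , q~τm , τm~w))
        where
        open IsReflection reflection
        τx≡x : τ x ≡ x
        τx≡x = reflection-fixes-commonNeighbour reflection x~p x~q
        τw≡w : τ w ≡ w
        τw≡w = reflection-fixes-equidistant reflection
          (commonNeighbour⇒Dist2 (p≢w ∘ sym) (p≁w ∘ Adj-sym) (Adj-sym m~w) (Adj-sym p~m))
          (commonNeighbour⇒Dist2 (q≢w ∘ sym) (q≁w ∘ Adj-sym) (Adj-sym x~w) x~q)
        x~τm : Adj x (τ m)
        x~τm = subst (λ t → Adj t (τ m)) τx≡x (reflection-preserves-Adj reflection x~m)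
        q~τm : Adj q (τ m)
        q~τm = subst (λ t → Adj t (τ m)) maps (reflection-preserves-Adj reflection p~m)
        τm~w : Adj (τ m) w
        τm~w = subst (Adj (τ m)) τw≡w (reflection-preserves-Adj reflection m~w)

      WithinTwo-along-sphereWalk : ∀ {q} (p : Walk G q w) →
                                   All (Sphere G 1 x) (vertices G p) → WithinTwo q
      WithinTwo-along-sphereWalk [] _ = inj₁ refl
      WithinTwo-along-sphereWalk (q~p ∷ p) (x-q ∷ x-rest) =
        WithinTwo-backward (Dist1⇒Adj x-q) (Dist1⇒Adj (head p x-rest)) q~p
                           (WithinTwo-along-sphereWalk p x-rest)
        where
        head : ∀ {u v} (r : Walk G u v) → All (Sphere G 1 x) (vertices G r) → Sphere G 1 x u
        head [] (x-u ∷ _) = x-u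
        head (_ ∷ _) (x-u ∷ _) = x-u

    sphere-commonNeighbour : ∀ x → InducedConnected G (Sphere G 1 x) →
                             ∀ {u v} → Sphere G 1 x u → Sphere G 1 x v → u ≢ v → ¬ Adj u v →
                             ∃[ c ] Adj x c × Adj u c × Adj c v
    sphere-commonNeighbour x connected {u} {v} x-u x-v u≢v u≁v
      with connected u v x-u x-v
    ... | p , p⊆S₁ with WithinTwo-along-sphereWalk x v (Dist1⇒Adj x-v) p p⊆S₁
    ...   | inj₁ u≡v = ⊥-elim (u≢v u≡v)
    ...   | inj₂ (inj₁ u~v) = ⊥-elim (u≁v u~v)
    ...   | inj₂ (inj₂ c) = c

lemma2p10 : (G : Graph) → Connected G → Reflective G →
    (x : Fin (Graph.n G)) → InducedConnected G (Sphere G 1 x) → Isometric G (Sphere G 1 x)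
lemma2p10 G _ reflective x connected u v x-u x-v with u ≟ v
... | yes refl = [] , (([] , refl) , λ _ → z≤n) , x-u ∷ []
... | no u≢v with neighbours-Adj? G reflective (Dist1⇒Adj G x-u) (Dist1⇒Adj G x-v)
...   | yes u~v = u~v ∷ [] , Adj⇒Dist1 G u~v , x-u ∷ x-v ∷ []
...   | no u≁v with sphere-commonNeighbour G reflective x connected x-u x-v u≢v u≁v
...     | c , x~c , u~c , c~v =
          u~c ∷ c~v ∷ [] , commonNeighbour⇒Dist2 G u≢v u≁v u~c c~v , x-u ∷ Adj⇒Dist1 G x~c ∷ x-v ∷ []
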